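{- Let $n \geq 3$ be an integer and let $\{D_I\}_{I \in \binom{[n]}{n-1}}$ be a family of positive real numbers indexed by the $(n-1)$-subsets of $[n]=\{1,\dots,n\}$; write $D_{\hat{i}}$ for $D_{[n]\setminus\{i\}}$. There exists a positive-weighted graph $\mathcal{G}=(G,w)$ with exactly $n$ vertices, namely $1,\dots,n$, such that $D_{\hat{i}}(\mathcal{G})=D_{\hat{i}}$ for every $i\in[n]$ if and only if the following two conditions hold: (i) $(n-2)D_{\hat{i}} \leq \sum_{j \in [n]\setminus\{i\}} D_{\hat{j}}$ for every $i \in [n]$; (ii) if the maximum of $\{D_{\hat{i}}\}_{i\in[n]}$ is achieved at least twice (i.e. by at least two distinct indices), then all the inequalities in (i) are strict.
   Context: All graphs are simple and finite. A positive-weighted graph $\mathcal{G}=(G,w)$ is a graph $G$ together with a function $w:E(G)\to\mathbb{R}_{>0}$; for a subgraph $G'$ of $G$, $w(G')$ is the sum of the weights of the edges of $G'$. For distinct vertices $i_1,\dots,i_k$ of $G$, $D_{i_1,\dots,i_k}(\mathcal{G})$ is the minimum of $w(R)$ over all connected subgraphs $R$ of $G$ whose vertex set contains $i_1,\dots,i_k$. For $i\in[n]$, $D_{\hat{i}}(\mathcal{G})$ denotes $D_{[n]\setminus\{i\}}(\mathcal{G})$. -}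

module Defs where

open import Level using (0ℓ)
open import Data.Nat using (ℕ; zero; suc; _∸_; _<ᵇ_)
open import Data.Fin using (Fin; toℕ) renaming (zero to fzero; suc to fsuc)
open import Data.Fin.Properties using (_≟_)
open import Data.Bool using (Bool; true; false; if_then_else_; _∧_)
open import Data.Product using (Σ; ∃; _×_; _,_)
open import Data.Sum using (_⊎_)
open import Relation.Nullary using (¬_; Dec; does)
open import Relation.Binary.PropositionalEquality using (_≡_)
open import Relation.Binary.Structures using (IsStrictTotalOrder)
open import Algebra.Structures using (IsCommutativeRing)

-- The real numbers, axiomatised as a Dedekind-complete ordered field
-- (this characterises ℝ up to unique isomorphism).  The theorem is
-- stated for an arbitrary such structure.

record Reals : Set₁ where
  infixl 6 _+_
  infixl 7 _*_
  infix 4 _<_ _≤_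
  field
    ℝ   : Set
    _+_ : ℝ → ℝ → ℝ
    _*_ : ℝ → ℝ → ℝ
    -_  : ℝ → ℝ
    0r  : ℝ
    1r  : ℝ
    isCommutativeRing : IsCommutativeRing _≡_ _+_ _*_ -_ 0r 1r
    inv : (x : ℝ) → ¬ (x ≡ 0r) → ℝ
    inv-inverse : ∀ x (p : ¬ (x ≡ 0r)) → x * inv x p ≡ 1r
    _<_ : ℝ → ℝ → Set
    isStrictTotalOrder : IsStrictTotalOrder _≡_ _<_
    0<1 : 0r < 1r
    +-mono-< : ∀ {x y} z → x < y → x + z < y + z
    *-pos : ∀ {x y} → 0r < x → 0r < y → 0r < x * y

  _≤_ : ℝ → ℝ → Set
  x ≤ y = x < y ⊎ x ≡ y

  UpperBound : (ℝ → Set) → ℝ → Set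
  UpperBound P b = ∀ x → P x → x ≤ b

  field
    complete : (P : ℝ → Set) → ∃ P → ∃ (UpperBound P) →
               Σ ℝ λ s → UpperBound P s × (∀ b → UpperBound P b → s ≤ b)

module _ (ℛ : Reals) where
  open Reals ℛ

  sumF : ∀ {n} → (Fin n → ℝ) → ℝ
  sumF {zero}  f = 0r
  sumF {suc n} f = f fzero + sumF (λ i → f (fsuc i))

  ofℕ : ℕ → ℝ
  ofℕ zero    = 0r
  ofℕ (suc k) = 1r + ofℕ k

  record WGraph (n : ℕ) : Set where
    field
      adj       : Fin n → Fin n → Bool
      adj-sym   : ∀ i j → adj i j ≡ adj j i
      adj-irrefl : ∀ i → adj i i ≡ false
      w         : Fin n → Fin n → ℝ
      w-sym     : ∀ i j → w i j ≡ w j i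
      w-pos     : ∀ i j → adj i j ≡ true → 0r < w i j

  data Path {n : ℕ} (e : Fin n → Fin n → Bool) : Fin n → Fin n → Set where
    here : ∀ {u} → Path e u u
    step : ∀ {u v x} → e u v ≡ true → Path e v x → Path e u x

  record Subgraph {n : ℕ} (G : WGraph n) : Set where
    open WGraph G
    field
      vs      : Fin n → Bool
      es      : Fin n → Fin n → Bool
      es-sym  : ∀ i j → es i j ≡ es j i
      es⊆adj  : ∀ i j → es i j ≡ true → adj i j ≡ true
      es-ends : ∀ i j → es i j ≡ true → vs i ≡ true

  module _ {n : ℕ} {G : WGraph n} where
    open WGraph G
    open Subgraph

    Connected : Subgraph G → Set
    Connected R = ∀ u v → vs R u ≡ true → vs R v ≡ true → Path (es R) u v

    Contains : Subgraph G → (Fin n → Set) → Set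
    Contains R S = ∀ v → S v → vs R v ≡ true

    weight : Subgraph G → ℝ
    weight R = sumF (λ i → sumF (λ j →
      if (toℕ i <ᵇ toℕ j) ∧ es R i j then w i j else 0r))

  IsD : ∀ {n} → WGraph n → (Fin n → Set) → ℝ → Set
  IsD G S d =
    (Σ (Subgraph G) λ R → Connected R × Contains R S × weight R ≡ d) ×
    (∀ (R : Subgraph G) → Connected R → Contains R S → d ≤ weight R)

  hat : ∀ {n} → Fin n → Fin n → Set
  hat i v = ¬ (v ≡ i)

  sumExcept : ∀ {n} → (Fin n → ℝ) → Fin n → ℝ
  sumExcept D i = sumF (λ j → if does (j ≟ i) then 0r else D j)

  CondI : ∀ {n} → (Fin n → ℝ) → Set
  CondI {n} D = ∀ i → ofℕ (n ∸ 2) * D i ≤ sumExcept D i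

  CondII : ∀ {n} → (Fin n → ℝ) → Set
  CondII {n} D =
    (Σ (Fin n) λ i → Σ (Fin n) λ j → ¬ (i ≡ j) × (∀ k → D k ≤ D i) × D i ≡ D j) →
    ∀ i → ofℕ (n ∸ 2) * D i < sumExcept D i

-- Necessity. Fix i ≢ j and an optimal subgraph T for D_ĵ; it contains i, so breadth-first search
-- from i gives each k ∉ {i, j} a parent edge e_k of T, and these edges are distinct, whence
-- ∑ w(e_k) ≤ D_ĵ. Adding e_k to an optimal subgraph for D_k̂ spans G, so D_î ≤ D_k̂ + w(e_k).
-- Summing over the n − 2 vertices k ∉ {i, j} gives (i), strictly as soon as some such k has
-- D_î ≤ D_k̂; if the maximum is attained twice, such a k exists for every i (and n ≥ 3 leaves
-- room for j).
--
-- Sufficiency. Let M maximise D, S maximise D on the other vertices, Q = ∑_{k ≢ M} D_k̂ / (n − 2)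
-- and α_v = Q − D_v̂, which (i) and (ii) make positive for v ≢ M, with ∑_{v ≢ M} α_v = Q. Take all
-- edges through M or S, weighing w(Mv) = α_v and w(Sv) = α_v, except for one vertex O, where
-- w(SO) = α_O + D_M̂ − D_Ŝ. The star at M without i weighs D_î and the star at S weighs D_M̂.
-- Conversely every edge at v ≢ M weighs at least α_v, so rooting a spanning tree of a competitor at
-- M bounds its weight below by a sum of α's; a competitor avoiding M only has edges at S.

module Submission where

open import Defs
open import Algebra.Bundles using (CommutativeSemigroup)
open import Algebra.Structures using (IsCommutativeRing)
open import Data.Bool using (Bool; true; false; if_then_else_; not; _∧_; _∨_; T)
open import Data.Bool.Properties using (∨-comm; ∨-zeroʳ; ∨-identityʳ; ∧-zeroʳ)
import Data.Bool.Properties as Bool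
open import Data.Empty using (⊥-elim)
open import Data.Fin using (Fin; toℕ; punchIn; punchOut) renaming (zero to fzero; suc to fsuc)
open import Data.Fin.Properties
  using (_≟_; _<?_; <-cmp; any?; punchInᵢ≢i; punchIn-injective; punchIn-punchOut)
open import Data.Nat as ℕ using (ℕ; zero; suc; z≤n; s≤s; _<ᵇ_)
import Data.Nat.Properties as ℕ
open import Data.Product using (Σ; ∃; _×_; _,_; proj₁; proj₂)
open import Data.Sum using (_⊎_; inj₁; inj₂)
open import Data.Unit using (tt)
open import Function using (_∘_)
open import Function.Bundles using (_⇔_; mk⇔)
open import Level using (0ℓ)
open import Relation.Nullary using (¬_; Dec; does; yes; no)
open import Relation.Nullary.Decidable using (dec-true; dec-false; does-⇔; _×-dec_)
open import Relation.Binary.PropositionalEquality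
open import Relation.Binary.Definitions using (tri<; tri≈; tri>)
open import Relation.Binary.Structures using (IsStrictTotalOrder; IsPreorder)
import Relation.Binary.Reasoning.Base.Triple as Triple

∨-introˡ : ∀ {x y} → x ≡ true → x ∨ y ≡ true
∨-introˡ refl = refl

∨-introʳ : ∀ {x y} → y ≡ true → x ∨ y ≡ true
∨-introʳ {x} refl = ∨-zeroʳ x

avoids : ∀ {n} → Fin n → Fin n → Fin n → Bool
avoids i j k = not (does (k ≟ i)) ∧ not (does (k ≟ j))

avoids⇒≢ : ∀ {n} {i j k : Fin n} → avoids i j k ≡ true → ¬ k ≡ i × ¬ k ≡ j
avoids⇒≢ {i = i} {j} {k} k-avoids with k ≟ i | k ≟ j
... | no k≢i | no k≢j = k≢i , k≢j

third : ∀ {m} (a b : Fin (suc (suc (suc m)))) → ∃ λ c → ¬ c ≡ a × ¬ c ≡ b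
third {m} a b with b ≟ a
... | yes refl = punchIn a fzero , punchInᵢ≢i a fzero , punchInᵢ≢i a fzero
... | no b≢a = c , punchInᵢ≢i a _ , c≢b
  where
  a≢b : ¬ a ≡ b
  a≢b a≡b = b≢a (sym a≡b)
  b′ : Fin (suc (suc m))
  b′ = punchOut a≢b
  c : Fin (suc (suc (suc m)))
  c = punchIn a (punchIn b′ fzero)
  c≢b : ¬ c ≡ b
  c≢b c≡b = punchInᵢ≢i b′ fzero (punchIn-injective a _ _ (trans c≡b (sym (punchIn-punchOut a≢b))))

module OrderedFieldProperties (ℛ : Reals) where
  open Reals ℛ public
  open IsCommutativeRing isCommutativeRing public
    using (+-assoc; +-comm; +-identityˡ; +-identityʳ; -‿inverseˡ; -‿inverseʳ;
           *-assoc; *-identityˡ; distribˡ; distribʳ; zeroˡ; +-isCommutativeSemigroup)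
  open IsStrictTotalOrder isStrictTotalOrder public
    using (compare) renaming (trans to <-trans)
  open ≡-Reasoning

  +-commutativeSemigroup : CommutativeSemigroup 0ℓ 0ℓ
  +-commutativeSemigroup = record { isCommutativeSemigroup = +-isCommutativeSemigroup }

  open import Algebra.Properties.CommutativeSemigroup +-commutativeSemigroup public
    using (interchange)

  infixl 6 _-_
  _-_ : ℝ → ℝ → ℝ
  x - y = x + (- y)

  <-irrefl : ∀ {x} → ¬ x < x
  <-irrefl = IsStrictTotalOrder.irrefl isStrictTotalOrder refl

  ≤-refl : ∀ {x} → x ≤ x
  ≤-refl = inj₂ refl

  ≤-reflexive : ∀ {x y} → x ≡ y → x ≤ y
  ≤-reflexive = inj₂

  ≤-trans : ∀ {x y z} → x ≤ y → y ≤ z → x ≤ z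
  ≤-trans (inj₁ x<y) (inj₁ y<z) = inj₁ (<-trans x<y y<z)
  ≤-trans (inj₁ x<y) (inj₂ refl) = inj₁ x<y
  ≤-trans (inj₂ refl) y≤z = y≤z

  <-≤-trans : ∀ {x y z} → x < y → y ≤ z → x < z
  <-≤-trans x<y (inj₁ y<z) = <-trans x<y y<z
  <-≤-trans x<y (inj₂ refl) = x<y

  ≤-<-trans : ∀ {x y z} → x ≤ y → y < z → x < z
  ≤-<-trans (inj₁ x<y) y<z = <-trans x<y y<z
  ≤-<-trans (inj₂ refl) y<z = y<z

  <⇒≱ : ∀ {x y} → x < y → ¬ y ≤ x
  <⇒≱ x<y y≤x = <-irrefl (<-≤-trans x<y y≤x)

  +-monoʳ-< : ∀ z {x y} → x < y → z + x < z + y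
  +-monoʳ-< z {x} {y} x<y = subst₂ _<_ (+-comm x z) (+-comm y z) (+-mono-< z x<y)

  +-monoˡ-≤ : ∀ z {x y} → x ≤ y → x + z ≤ y + z
  +-monoˡ-≤ z (inj₁ x<y) = inj₁ (+-mono-< z x<y)
  +-monoˡ-≤ z (inj₂ refl) = ≤-refl

  +-monoʳ-≤ : ∀ z {x y} → x ≤ y → z + x ≤ z + y
  +-monoʳ-≤ z (inj₁ x<y) = inj₁ (+-monoʳ-< z x<y)
  +-monoʳ-≤ z (inj₂ refl) = ≤-refl

  +-mono-≤ : ∀ {x y u v} → x ≤ y → u ≤ v → x + u ≤ y + v
  +-mono-≤ {y = y} {u} x≤y u≤v = ≤-trans (+-monoˡ-≤ u x≤y) (+-monoʳ-≤ y u≤v)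

  +-mono-<-≤ : ∀ {x y u v} → x < y → u ≤ v → x + u < y + v
  +-mono-<-≤ {y = y} {u} x<y u≤v = <-≤-trans (+-mono-< u x<y) (+-monoʳ-≤ y u≤v)

  +-mono-≤-< : ∀ {x y u v} → x ≤ y → u < v → x + u < y + v
  +-mono-≤-< {y = y} {u} x≤y u<v = ≤-<-trans (+-monoˡ-≤ u x≤y) (+-monoʳ-< y u<v)

  x+y-y≡x : ∀ x y → x + y - y ≡ x
  x+y-y≡x x y = begin
    x + y - y     ≡⟨ +-assoc x y (- y) ⟩
    x + (y - y)   ≡⟨ cong (x +_) (-‿inverseʳ y) ⟩
    x + 0r        ≡⟨ +-identityʳ x ⟩
    x             ∎

  x-y+y≡x : ∀ x y → x - y + y ≡ x
  x-y+y≡x x y = begin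
    x - y + y        ≡⟨ +-assoc x (- y) y ⟩
    x + (- y + y)    ≡⟨ cong (x +_) (-‿inverseˡ y) ⟩
    x + 0r           ≡⟨ +-identityʳ x ⟩
    x                ∎

  +-cancelʳ-≡ : ∀ z {x y} → x + z ≡ y + z → x ≡ y
  +-cancelʳ-≡ z {x} {y} eq = begin
    x              ≡⟨ x+y-y≡x x z ⟨
    x + z - z      ≡⟨ cong (_- z) eq ⟩
    y + z - z      ≡⟨ x+y-y≡x y z ⟩
    y              ∎

  +-cancelʳ-≤ : ∀ z {x y} → x + z ≤ y + z → x ≤ y
  +-cancelʳ-≤ z {x} {y} (inj₁ lt) = inj₁ (subst₂ _<_ (x+y-y≡x x z) (x+y-y≡x y z) (+-mono-< (- z) lt))
  +-cancelʳ-≤ z (inj₂ eq) = inj₂ (+-cancelʳ-≡ z eq)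

  x<y⇒0<y-x : ∀ {x y} → x < y → 0r < y - x
  x<y⇒0<y-x {x} {y} x<y = subst (_< y - x) (-‿inverseʳ x) (+-mono-< (- x) x<y)

  x≤y⇒0≤y-x : ∀ {x y} → x ≤ y → 0r ≤ y - x
  x≤y⇒0≤y-x (inj₁ x<y) = inj₁ (x<y⇒0<y-x x<y)
  x≤y⇒0≤y-x {x} (inj₂ refl) = inj₂ (sym (-‿inverseʳ x))

  -‿antitone-≤ : ∀ x {y z} → y ≤ z → x - z ≤ x - y
  -‿antitone-≤ x {y} {z} y≤z = +-cancelʳ-≤ z (subst (_≤ x - y + z) (sym (x-y+y≡x x z))
    (subst (_≤ x - y + z) (x-y+y≡x x y) (+-monoʳ-≤ (x - y) y≤z)))

  x≤x+y : ∀ x {y} → 0r ≤ y → x ≤ x + y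
  x≤x+y x {y} 0≤y = subst (_≤ x + y) (+-identityʳ x) (+-monoʳ-≤ x 0≤y)

  x<x+y : ∀ x {y} → 0r < y → x < x + y
  x<x+y x {y} 0<y = subst (_< x + y) (+-identityʳ x) (+-monoʳ-< x 0<y)

  *-monoˡ-< : ∀ {c x y} → 0r < c → x < y → c * x < c * y
  *-monoˡ-< {c} {x} {y} 0<c x<y = subst₂ _<_ (+-identityˡ (c * x)) c[y-x]+cx≡cy
    (+-mono-< (c * x) (*-pos 0<c (x<y⇒0<y-x x<y)))
    where
    c[y-x]+cx≡cy : c * (y - x) + c * x ≡ c * y
    c[y-x]+cx≡cy = trans (sym (distribˡ c (y - x) x)) (cong (c *_) (x-y+y≡x y x))

  *-cancelˡ-≤ : ∀ {c x y} → 0r < c → c * x ≤ c * y → x ≤ y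
  *-cancelˡ-≤ {x = x} {y} 0<c cx≤cy with compare x y
  ... | tri< x<y _ _ = inj₁ x<y
  ... | tri≈ _ x≡y _ = inj₂ x≡y
  ... | tri> _ _ y<x = ⊥-elim (<⇒≱ (*-monoˡ-< 0<c y<x) cx≤cy)

  *-cancelˡ-< : ∀ {c x y} → 0r < c → c * x < c * y → x < y
  *-cancelˡ-< {x = x} {y} 0<c cx<cy with compare x y
  ... | tri< x<y _ _ = x<y
  ... | tri≈ _ refl _ = ⊥-elim (<-irrefl cx<cy)
  ... | tri> _ _ y<x = ⊥-elim (<-irrefl (<-trans cx<cy (*-monoˡ-< 0<c y<x)))

  *-inverse-cancelˡ : ∀ c (c≢0 : ¬ c ≡ 0r) x → c * (inv c c≢0 * x) ≡ x
  *-inverse-cancelˡ c c≢0 x = begin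
    c * (inv c c≢0 * x)   ≡⟨ *-assoc c (inv c c≢0) x ⟨
    c * inv c c≢0 * x     ≡⟨ cong (_* x) (inv-inverse c c≢0) ⟩
    1r * x                ≡⟨ *-identityˡ x ⟩
    x                     ∎

  0<⇒≢0 : ∀ {x} → 0r < x → ¬ x ≡ 0r
  0<⇒≢0 0<x refl = <-irrefl 0<x

  ofℕ-suc-* : ∀ k x → ofℕ ℛ (suc k) * x ≡ x + ofℕ ℛ k * x
  ofℕ-suc-* k x = trans (distribʳ x 1r (ofℕ ℛ k)) (cong (_+ ofℕ ℛ k * x) (*-identityˡ x))

  0<ofℕ-suc : ∀ k → 0r < ofℕ ℛ (suc k)
  0<ofℕ-suc zero = subst (0r <_) (sym (+-identityʳ 1r)) 0<1
  0<ofℕ-suc (suc k) = subst (_< ofℕ ℛ (suc (suc k))) (+-identityʳ 0r)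
    (+-mono-<-≤ 0<1 (inj₁ (0<ofℕ-suc k)))

  <-asym : ∀ {x y} → x < y → ¬ y < x
  <-asym x<y y<x = <-irrefl (<-trans x<y y<x)

  ≤-isPreorder : IsPreorder _≡_ _≤_
  ≤-isPreorder = record { isEquivalence = isEquivalence ; reflexive = ≤-reflexive ; trans = ≤-trans }

  module ≤-Reasoning = Triple ≤-isPreorder <-asym <-trans (subst (_ <_) , subst (_< _))
                                inj₁ <-≤-trans ≤-<-trans

module FiniteSums (ℛ : Reals) where
  open OrderedFieldProperties ℛ
  open ≡-Reasoning

  ∑ : ∀ {n} → (Fin n → ℝ) → ℝ
  ∑ = sumF ℛ

  ∑-cong : ∀ {n} {f g : Fin n → ℝ} → (∀ k → f k ≡ g k) → ∑ f ≡ ∑ g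
  ∑-cong {zero} f≡g = refl
  ∑-cong {suc n} f≡g = cong₂ _+_ (f≡g fzero) (∑-cong (f≡g ∘ fsuc))

  ∑-zero : ∀ {n} → ∑ {n} (λ _ → 0r) ≡ 0r
  ∑-zero {zero} = refl
  ∑-zero {suc n} = trans (cong (0r +_) (∑-zero {n})) (+-identityʳ 0r)

  ∑-distrib-+ : ∀ {n} (f g : Fin n → ℝ) → ∑ (λ k → f k + g k) ≡ ∑ f + ∑ g
  ∑-distrib-+ {zero} f g = sym (+-identityʳ 0r)
  ∑-distrib-+ {suc n} f g =
    trans (cong (f fzero + g fzero +_) (∑-distrib-+ (f ∘ fsuc) (g ∘ fsuc))) (interchange _ _ _ _)

  ∑-mono-≤ : ∀ {n} {f g : Fin n → ℝ} → (∀ k → f k ≤ g k) → ∑ f ≤ ∑ g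
  ∑-mono-≤ {zero} f≤g = ≤-refl
  ∑-mono-≤ {suc n} f≤g = +-mono-≤ (f≤g fzero) (∑-mono-≤ (λ k → f≤g (fsuc k)))

  ∑-mono-< : ∀ {n} {f g : Fin n → ℝ} → (∀ k → f k ≤ g k) → ∀ j → f j < g j → ∑ f < ∑ g
  ∑-mono-< {suc n} f≤g fzero fj<gj = +-mono-<-≤ fj<gj (∑-mono-≤ (λ k → f≤g (fsuc k)))
  ∑-mono-< {suc n} f≤g (fsuc j) fj<gj = +-mono-≤-< (f≤g fzero) (∑-mono-< (λ k → f≤g (fsuc k)) j fj<gj)

  ∑-const : ∀ {n} x → ∑ {n} (λ _ → x) ≡ ofℕ ℛ n * x
  ∑-const {zero} x = sym (zeroˡ x)
  ∑-const {suc n} x = trans (cong (x +_) (∑-const {n} x)) (sym (ofℕ-suc-* n x))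

  ∑-comm : ∀ {n m} (F : Fin n → Fin m → ℝ) → ∑ (λ a → ∑ (F a)) ≡ ∑ (λ b → ∑ (λ a → F a b))
  ∑-comm {zero} {m} F = sym (∑-zero {m})
  ∑-comm {suc n} F = trans (cong (∑ (F fzero) +_) (∑-comm (λ a → F (fsuc a))))
    (sym (∑-distrib-+ (F fzero) (λ b → ∑ (λ a → F (fsuc a) b))))

  ∑-indicator : ∀ {n} (c : Fin n) (f : Fin n → ℝ) → ∑ (λ k → if does (k ≟ c) then f k else 0r) ≡ f c
  ∑-indicator {suc n} fzero f = trans (cong (f fzero +_) (∑-zero {n})) (+-identityʳ (f fzero))
  ∑-indicator {suc n} (fsuc c) f = trans (+-identityˡ _) (∑-indicator c (λ k → f (fsuc k)))

  if-∑ : ∀ {n} (d : Bool) (f : Fin n → ℝ) → (if d then ∑ f else 0r) ≡ ∑ (λ k → if d then f k else 0r)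
  if-∑ true f = refl
  if-∑ {n} false f = sym (∑-zero {n})

  -- sumExcept D i is definitionally ∑ (D ∖ i).
  infixl 5 _∖_
  _∖_ : ∀ {n} → (Fin n → ℝ) → Fin n → Fin n → ℝ
  (f ∖ c) k = if does (k ≟ c) then 0r else f k

  ∖-≢ : ∀ {n} (f : Fin n → ℝ) {c k} → ¬ k ≡ c → (f ∖ c) k ≡ f k
  ∖-≢ f {c} {k} k≢c rewrite dec-false (k ≟ c) k≢c = refl

  ∖-idem : ∀ {n} (f : Fin n → ℝ) c k → (f ∖ c ∖ c) k ≡ (f ∖ c) k
  ∖-idem f c k with does (k ≟ c)
  ... | true = refl
  ... | false = refl

  ∖∖-≢ : ∀ {n} (f : Fin n → ℝ) {i j k} → ¬ k ≡ i → ¬ k ≡ j → (f ∖ i ∖ j) k ≡ f k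
  ∖∖-≢ f {i} {j} {k} k≢i k≢j rewrite dec-false (k ≟ j) k≢j | dec-false (k ≟ i) k≢i = refl

  ∖∖-≡0 : ∀ {n} (f : Fin n → ℝ) {i j} → f i ≡ 0r → f j ≡ 0r → ∀ k → (f ∖ i ∖ j) k ≡ f k
  ∖∖-≡0 f {i} {j} fi≡0 fj≡0 k with k ≟ i | k ≟ j
  ... | _ | yes refl = sym fj≡0
  ... | yes refl | no _ = sym fi≡0
  ... | no _ | no _ = refl

  ∖∖-avoids : ∀ {n} (f : Fin n → ℝ) i j k → (f ∖ i ∖ j) k ≡ (if avoids i j k then f k else 0r)
  ∖∖-avoids f i j k with does (k ≟ i) | does (k ≟ j)
  ... | true | true = refl
  ... | true | false = refl
  ... | false | true = refl
  ... | false | false = refl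

  ∖∖-distrib-+ : ∀ {n} (f g : Fin n → ℝ) i j k →
                 ((λ v → f v + g v) ∖ i ∖ j) k ≡ (f ∖ i ∖ j) k + (g ∖ i ∖ j) k
  ∖∖-distrib-+ f g i j k with does (k ≟ i) | does (k ≟ j)
  ... | _ | true = sym (+-identityʳ 0r)
  ... | true | false = sym (+-identityʳ 0r)
  ... | false | false = refl

  ∖∖-mono-≤ : ∀ {n} {f g : Fin n → ℝ} {i j} → (∀ k → ¬ k ≡ i → ¬ k ≡ j → f k ≤ g k) →
              ∀ k → (f ∖ i ∖ j) k ≤ (g ∖ i ∖ j) k
  ∖∖-mono-≤ {i = i} {j} f≤g k with k ≟ i | k ≟ j
  ... | _ | yes _ = ≤-refl
  ... | yes _ | no _ = ≤-refl
  ... | no k≢i | no k≢j = f≤g k k≢i k≢j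

  ∑-∖ : ∀ {n} (f : Fin n → ℝ) c → ∑ f ≡ ∑ (f ∖ c) + f c
  ∑-∖ f c = begin
    ∑ f                                                   ≡⟨ ∑-cong split ⟩
    ∑ (λ k → (f ∖ c) k + (if does (k ≟ c) then f k else 0r)) ≡⟨ ∑-distrib-+ (f ∖ c) _ ⟩
    ∑ (f ∖ c) + ∑ (λ k → if does (k ≟ c) then f k else 0r)  ≡⟨ cong (∑ (f ∖ c) +_) (∑-indicator c f) ⟩
    ∑ (f ∖ c) + f c                                       ∎
    where
    split : ∀ k → f k ≡ (f ∖ c) k + (if does (k ≟ c) then f k else 0r)
    split k with does (k ≟ c)
    ... | true = sym (+-identityˡ (f k))
    ... | false = sym (+-identityʳ (f k))

  ∑-∖∖ : ∀ {n} (f : Fin n → ℝ) {i j} → ¬ j ≡ i → ∑ (f ∖ i) ≡ ∑ (f ∖ i ∖ j) + f j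
  ∑-∖∖ f {i} {j} j≢i = trans (∑-∖ (f ∖ i) j) (cong (∑ (f ∖ i ∖ j) +_) (∖-≢ f j≢i))

  ∑-const-∖ : ∀ {n} x (i : Fin (suc n)) → ∑ ((λ _ → x) ∖ i) ≡ ofℕ ℛ n * x
  ∑-const-∖ {n} x i = +-cancelʳ-≡ x (begin
    ∑ ((λ _ → x) ∖ i) + x     ≡⟨ ∑-∖ (λ _ → x) i ⟨
    ∑ {suc n} (λ _ → x)       ≡⟨ ∑-const {suc n} x ⟩
    ofℕ ℛ (suc n) * x         ≡⟨ ofℕ-suc-* n x ⟩
    x + ofℕ ℛ n * x           ≡⟨ +-comm x _ ⟩
    ofℕ ℛ n * x + x           ∎)

  ∑-const-∖∖ : ∀ {n} x (i j : Fin (suc (suc n))) → ¬ j ≡ i → ∑ ((λ _ → x) ∖ i ∖ j) ≡ ofℕ ℛ n * x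
  ∑-const-∖∖ {n} x i j j≢i = +-cancelʳ-≡ x (begin
    ∑ ((λ _ → x) ∖ i ∖ j) + x  ≡⟨ ∑-∖∖ (λ _ → x) j≢i ⟨
    ∑ ((λ _ → x) ∖ i)          ≡⟨ ∑-const-∖ x i ⟩
    ofℕ ℛ (suc n) * x          ≡⟨ ofℕ-suc-* n x ⟩
    x + ofℕ ℛ n * x            ≡⟨ +-comm x _ ⟩
    ofℕ ℛ n * x + x            ∎)

  when< : ∀ {n} → Fin n → Fin n → ℝ → ℝ
  when< a b x = if toℕ a <ᵇ toℕ b then x else 0r

  -- Each off-diagonal term H a b is moved to whichever of (a, b), (b, a) is increasing.
  ∑∑-upper : ∀ {n} (H : Fin n → Fin n → ℝ) → (∀ a → H a a ≡ 0r) →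
             ∑ (λ a → ∑ (H a)) ≡ ∑ (λ a → ∑ (λ b → when< a b (H a b + H b a)))
  ∑∑-upper {n} H H-diag = begin
    ∑ (λ a → ∑ (H a))
      ≡⟨ ∑-cong {n} (λ a → ∑-cong (λ b → split a b)) ⟩
    ∑ (λ a → ∑ (λ b → when< a b (H a b) + when< b a (H a b)))
      ≡⟨ ∑-cong {n} (λ a → ∑-distrib-+ {n} _ _) ⟩
    ∑ (λ a → ∑ (λ b → when< a b (H a b)) + ∑ (λ b → when< b a (H a b)))
      ≡⟨ ∑-distrib-+ {n} _ _ ⟩
    ∑ (λ a → ∑ (λ b → when< a b (H a b))) + ∑ (λ a → ∑ (λ b → when< b a (H a b)))
      ≡⟨ cong (∑ (λ a → ∑ (λ b → when< a b (H a b))) +_) (∑-comm (λ a b → when< b a (H a b))) ⟩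
    ∑ (λ a → ∑ (λ b → when< a b (H a b))) + ∑ (λ a → ∑ (λ b → when< a b (H b a)))
      ≡⟨ ∑-distrib-+ {n} _ _ ⟨
    ∑ (λ a → ∑ (λ b → when< a b (H a b)) + ∑ (λ b → when< a b (H b a)))
      ≡⟨ ∑-cong {n} (λ a → ∑-distrib-+ {n} _ _) ⟨
    ∑ (λ a → ∑ (λ b → when< a b (H a b) + when< a b (H b a)))
      ≡⟨ ∑-cong {n} (λ a → ∑-cong (λ b → when<-+ a b)) ⟩
    ∑ (λ a → ∑ (λ b → when< a b (H a b + H b a)))  ∎
    where
    split : ∀ a b → H a b ≡ when< a b (H a b) + when< b a (H a b)
    split a b with <-cmp a b
    ... | tri< a<b _ b≮a rewrite dec-true (a <? b) a<b | dec-false (b <? a) b≮a = sym (+-identityʳ _)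
    ... | tri> a≮b _ b<a rewrite dec-false (a <? b) a≮b | dec-true (b <? a) b<a = sym (+-identityˡ _)
    ... | tri≈ a≮b refl _ rewrite dec-false (a <? a) a≮b = trans (H-diag a) (sym (+-identityʳ 0r))
    when<-+ : ∀ a b → when< a b (H a b) + when< a b (H b a) ≡ when< a b (H a b + H b a)
    when<-+ a b with toℕ a <ᵇ toℕ b
    ... | true = refl
    ... | false = +-identityʳ 0r

module Maxima (ℛ : Reals) where
  open OrderedFieldProperties ℛ

  argmax : ∀ {n} (f : Fin (suc n) → ℝ) → ∃ λ M → ∀ k → f k ≤ f M
  argmax {zero} f = fzero , λ { fzero → ≤-refl }
  argmax {suc n} f with argmax (λ k → f (fsuc k))
  ... | M , max with compare (f fzero) (f (fsuc M))
  ...   | tri< f₀<fM _ _ = fsuc M , λ { fzero → inj₁ f₀<fM ; (fsuc k) → max k }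
  ...   | tri≈ _ f₀≡fM _ = fsuc M , λ { fzero → inj₂ f₀≡fM ; (fsuc k) → max k }
  ...   | tri> _ _ fM<f₀ = fzero , λ { fzero → ≤-refl ; (fsuc k) → ≤-trans (max k) (inj₁ fM<f₀) }

  argmax-except : ∀ {n} (f : Fin (suc (suc n)) → ℝ) c → ∃ λ s → ¬ s ≡ c × (∀ u → ¬ u ≡ c → f u ≤ f s)
  argmax-except f c with argmax (λ k → f (punchIn c k))
  ... | s , max = punchIn c s , punchInᵢ≢i c s , λ u u≢c →
    subst (λ v → f v ≤ f (punchIn c s)) (punchIn-punchOut (λ c≡u → u≢c (sym c≡u))) (max _)

module Walks {ℛ : Reals} {n : ℕ} {e : Fin n → Fin n → Bool} where

  infixr 5 _++ʷ_
  _++ʷ_ : ∀ {u v x} → Path ℛ e u v → Path ℛ e v x → Path ℛ e u x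
  here ++ʷ Q = Q
  step h P ++ʷ Q = step h (P ++ʷ Q)

  reverseʷ : (∀ a b → e a b ≡ e b a) → ∀ {u v} → Path ℛ e u v → Path ℛ e v u
  reverseʷ e-sym here = here
  reverseʷ e-sym (step {u} {v} h P) = reverseʷ e-sym P ++ʷ step (trans (e-sym v u) h) here

  mapʷ : ∀ {e′} → (∀ a b → e a b ≡ true → e′ a b ≡ true) → ∀ {u v} → Path ℛ e u v → Path ℛ e′ u v
  mapʷ e⊆e′ here = here
  mapʷ e⊆e′ (step h P) = step (e⊆e′ _ _ h) (mapʷ e⊆e′ P)

-- least f b is the least k ≤ b with f k, or b if there is none.
least : (ℕ → Bool) → ℕ → ℕ
least f zero = zero
least f (suc b) = if f zero then zero else suc (least (f ∘ suc) b)

least-holds : ∀ (f : ℕ → Bool) b → f b ≡ true → f (least f b) ≡ true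
least-holds f zero fb = fb
least-holds f (suc b) fb with f zero in f0
... | true = f0
... | false = least-holds (f ∘ suc) b fb

least-minimal : ∀ (f : ℕ → Bool) b {k} → f k ≡ true → least f b ℕ.≤ k
least-minimal f zero fk = z≤n
least-minimal f (suc b) {k} fk with f zero in f0
... | true = z≤n
least-minimal f (suc b) {zero} fk | false with () ← trans (sym f0) fk
least-minimal f (suc b) {suc k} fk | false = s≤s (least-minimal (f ∘ suc) b fk)

module BreadthFirst {ℛ : Reals} {n : ℕ} (e : Fin n → Fin n → Bool) (r : Fin n) where

  reach : ℕ → Fin n → Bool
  Closer : ℕ → Fin n → Fin n → Set
  Closer k v u = e v u ≡ true × reach k u ≡ true

  closer? : ∀ k v → Dec (∃ (Closer k v))
  closer? k v = any? λ u → (e v u Bool.≟ true) ×-dec (reach k u Bool.≟ true)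

  reach zero v = does (v ≟ r)
  reach (suc k) v = reach k v ∨ does (closer? k v)

  path⇒reach : ∀ {v} → Path ℛ e v r → ∃ λ k → reach k v ≡ true
  path⇒reach here = zero , dec-true (r ≟ r) refl
  path⇒reach (step {v} {u} evu P) with path⇒reach P
  ... | k , reach-u = suc k , trans (cong (reach k v ∨_) (dec-true (closer? k v) (u , evu , reach-u)))
                                    (∨-zeroʳ (reach k v))

  closer : ℕ → Fin n → Fin n
  closer k v with closer? k v
  ... | yes (u , _) = u
  ... | no _ = v

  closer-spec : ∀ k v → does (closer? k v) ≡ true → Closer k v (closer k v)
  closer-spec k v found with closer? k v
  ... | yes (u , u-closer) = u-closer

  module _ (inR : Fin n → Bool) (toRoot : ∀ v → inR v ≡ true → Path ℛ e v r) where

    bound : Fin n → ℕ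
    bound v with inR v Bool.≟ true
    ... | yes v∈R = proj₁ (path⇒reach (toRoot v v∈R))
    ... | no _ = zero

    reach-bound : ∀ v → inR v ≡ true → reach (bound v) v ≡ true
    reach-bound v v∈R with inR v Bool.≟ true
    ... | yes v∈R′ = proj₂ (path⇒reach (toRoot v v∈R′))
    ... | no v∉R = ⊥-elim (v∉R v∈R)

    -- the distance from v to r, for v in the component of r
    level : Fin n → ℕ
    level v = least (λ k → reach k v) (bound v)

    parent : Fin n → Fin n
    parent v with level v
    ... | zero = v
    ... | suc k = closer k v

    parent-spec : ∀ v → inR v ≡ true → ¬ v ≡ r → e v (parent v) ≡ true × level (parent v) ℕ.< level v
    parent-spec v v∈R v≢r
      with level v in level-v | least-holds (λ k → reach k v) (bound v) (reach-bound v v∈R)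
    ... | zero | reach₀ with v ≟ r
    ...   | yes v≡r = ⊥-elim (v≢r v≡r)
    ...   | no _ with () ← reach₀
    parent-spec v v∈R v≢r | suc k | reachₖ₊₁ with reach k v in reachₖ
    ...   | true =
      ⊥-elim (ℕ.n≮n k (subst (ℕ._≤ k) level-v (least-minimal (λ j → reach j v) (bound v) reachₖ)))
    ...   | false with closer-spec k v reachₖ₊₁
    ...     | evu , reach-u =
      evu , s≤s (least-minimal (λ j → reach j (closer k v)) (bound (closer k v)) reach-u)

module EdgeWeights (ℛ : Reals) {n : ℕ} (G : WGraph ℛ n) where
  open OrderedFieldProperties ℛ
  open FiniteSums ℛ
  open WGraph G
  open Subgraph
  open Walks

  es-pos : (R : Subgraph ℛ G) → ∀ a b → es R a b ≡ true → 0r < w a b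
  es-pos R a b eab = w-pos a b (es⊆adj R a b eab)

  es-endsʳ : (R : Subgraph ℛ G) → ∀ {a b} → es R a b ≡ true → vs R b ≡ true
  es-endsʳ R {a} {b} ab = es-ends R b a (trans (es-sym R b a) ab)

  0≤edge : (R : Subgraph ℛ G) → ∀ a b → 0r ≤ (if es R a b then w a b else 0r)
  0≤edge R a b with es R a b in eab
  ... | true = inj₁ (es-pos R a b eab)
  ... | false = ≤-refl

  module _ (R : Subgraph ℛ G) (J : Fin n → Bool) (p : Fin n → Fin n) (level : Fin n → ℕ)
           (descent : ∀ v → J v ≡ true → es R v (p v) ≡ true × level (p v) ℕ.< level v) where

    private
      H : Fin n → Fin n → ℝ
      H a b = if does (b ≟ p a) then (if J a then w a b else 0r) else 0r

      H-diag : ∀ a → H a a ≡ 0r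
      H-diag a with a ≟ p a | J a in Ja
      ... | no _ | _ = refl
      ... | yes _ | false = refl
      ... | yes a≡pa | true = ⊥-elim (ℕ.<-irrefl (cong level (sym a≡pa)) (proj₂ (descent a Ja)))

      H-edge : ∀ a b → H a b ≤ (if es R a b then w a b else 0r)
      H-edge a b with b ≟ p a | J a in Ja
      ... | no _ | _ = 0≤edge R a b
      ... | yes _ | false = 0≤edge R a b
      ... | yes refl | true rewrite proj₁ (descent a Ja) = ≤-refl

      -- {a, b} cannot be the chosen edge of both endpoints, since levels strictly decrease along it.
      H-one-sided : ∀ a b → H a b ≡ 0r ⊎ H b a ≡ 0r
      H-one-sided a b with b ≟ p a | J a in Ja | a ≟ p b | J b in Jb
      ... | no _ | _ | _ | _ = inj₁ refl
      ... | yes _ | false | _ | _ = inj₁ refl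
      ... | yes _ | true | no _ | _ = inj₂ refl
      ... | yes _ | true | yes _ | false = inj₂ refl
      ... | yes b≡pa | true | yes a≡pb | true =
        ⊥-elim (ℕ.<-asym (subst (ℕ._< level a) (cong level (sym b≡pa)) (proj₂ (descent a Ja)))
                         (subst (ℕ._< level b) (cong level (sym a≡pb)) (proj₂ (descent b Jb))))

      H-pair : ∀ a b → H a b + H b a ≤ (if es R a b then w a b else 0r)
      H-pair a b with H-one-sided a b
      ... | inj₁ Hab≡0 rewrite Hab≡0 | es-sym R a b | w-sym a b =
        subst (_≤ _) (sym (+-identityˡ (H b a))) (H-edge b a)
      ... | inj₂ Hba≡0 rewrite Hba≡0 = subst (_≤ _) (sym (+-identityʳ (H a b))) (H-edge a b)

    ∑-descent-≤-weight : ∑ (λ v → if J v then w v (p v) else 0r) ≤ weight ℛ R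
    ∑-descent-≤-weight = subst (_≤ weight ℛ R) (sym ∑J≡∑∑H) (∑-mono-≤ λ a → ∑-mono-≤ λ b → upper a b)
      where
      ∑J≡∑∑H : ∑ (λ v → if J v then w v (p v) else 0r) ≡ ∑ (λ a → ∑ (λ b → when< a b (H a b + H b a)))
      ∑J≡∑∑H = trans (∑-cong (λ a → sym (∑-indicator (p a) (λ b → if J a then w a b else 0r))))
                     (∑∑-upper H H-diag)
      upper : ∀ a b → when< a b (H a b + H b a) ≤ (if (toℕ a <ᵇ toℕ b) ∧ es R a b then w a b else 0r)
      upper a b with toℕ a <ᵇ toℕ b
      ... | true = H-pair a b
      ... | false = ≤-refl

  hub⇒connected : (R : Subgraph ℛ G) (h : Fin n) →
                  (∀ v → vs R v ≡ true → Path ℛ (es R) v h) → Connected ℛ R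
  hub⇒connected R h toHub u v u∈R v∈R = toHub u u∈R ++ʷ reverseʷ (es-sym R) (toHub v v∈R)

  infixr 6 _∪_
  _∪_ : Subgraph ℛ G → Subgraph ℛ G → Subgraph ℛ G
  R ∪ R′ = record
    { vs = λ v → vs R v ∨ vs R′ v
    ; es = λ a b → es R a b ∨ es R′ a b
    ; es-sym = λ a b → cong₂ _∨_ (es-sym R a b) (es-sym R′ a b)
    ; es⊆adj = ∪-es⊆adj
    ; es-ends = ∪-es-ends
    }
    where
    ∪-es⊆adj : ∀ a b → es R a b ∨ es R′ a b ≡ true → adj a b ≡ true
    ∪-es⊆adj a b eab with es R a b in eRab
    ... | true = es⊆adj R a b eRab
    ... | false = es⊆adj R′ a b eab
    ∪-es-ends : ∀ a b → es R a b ∨ es R′ a b ≡ true → vs R a ∨ vs R′ a ≡ true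
    ∪-es-ends a b eab with es R a b in eRab
    ... | true = ∨-introˡ (es-ends R a b eRab)
    ... | false = ∨-introʳ (es-ends R′ a b eab)

  ∪-connected : ∀ {R R′ x} → Connected ℛ R → Connected ℛ R′ → vs R x ≡ true → vs R′ x ≡ true →
                Connected ℛ (R ∪ R′)
  ∪-connected {R} {R′} {x} R-conn R′-conn x∈R x∈R′ = hub⇒connected (R ∪ R′) x toX
    where
    toX : ∀ v → vs (R ∪ R′) v ≡ true → Path ℛ (es (R ∪ R′)) v x
    toX v v∈ with vs R v in v∈R
    ... | true = mapʷ (λ a b → ∨-introˡ) (R-conn v x v∈R x∈R)
    ... | false = mapʷ (λ a b → ∨-introʳ) (R′-conn v x v∈ x∈R′)

  weight-∪ : ∀ R R′ → weight ℛ (R ∪ R′) ≤ weight ℛ R + weight ℛ R′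
  weight-∪ R R′ = ≤-trans
    (∑-mono-≤ λ a → ≤-trans (∑-mono-≤ (pair a)) (≤-reflexive (∑-distrib-+ {n} _ _)))
    (≤-reflexive (∑-distrib-+ {n} _ _))
    where
    pair : ∀ a b → (if (toℕ a <ᵇ toℕ b) ∧ (es R a b ∨ es R′ a b) then w a b else 0r) ≤
                   (if (toℕ a <ᵇ toℕ b) ∧ es R a b then w a b else 0r) +
                   (if (toℕ a <ᵇ toℕ b) ∧ es R′ a b then w a b else 0r)
    pair a b with toℕ a <ᵇ toℕ b | es R a b in eRab | es R′ a b
    ... | false | _ | _ = ≤-reflexive (sym (+-identityʳ 0r))
    ... | true | true | true = x≤x+y (w a b) (inj₁ (es-pos R a b eRab))
    ... | true | true | false = ≤-reflexive (sym (+-identityʳ (w a b)))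
    ... | true | false | true = ≤-reflexive (sym (+-identityˡ (w a b)))
    ... | true | false | false = ≤-reflexive (sym (+-identityʳ 0r))

  module _ (c : Fin n) (L : Fin n → Bool) (L⊆adj : ∀ v → L v ≡ true → adj c v ≡ true) where

    private
      L-c : L c ≡ false
      L-c with L c in Lc
      ... | true with () ← trans (sym (L⊆adj c Lc)) (adj-irrefl c)
      ... | false = refl

      starEdge : Fin n → Fin n → Bool
      starEdge a b = (does (a ≟ c) ∧ L b) ∨ (does (b ≟ c) ∧ L a)

      star-es⊆adj : ∀ a b → starEdge a b ≡ true → adj a b ≡ true
      star-es⊆adj a b h with a ≟ c | b ≟ c
      ... | yes refl | yes refl rewrite L-c with () ← h
      ... | yes refl | no _ = L⊆adj b (trans (sym (∨-identityʳ (L b))) h)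
      ... | no _ | yes refl = trans (adj-sym a c) (L⊆adj a h)

      star-es-ends : ∀ a b → starEdge a b ≡ true → does (a ≟ c) ∨ L a ≡ true
      star-es-ends a b h with a ≟ c
      ... | yes _ = refl
      ... | no _ with b ≟ c
      ...   | yes _ = h

    star : Subgraph ℛ G
    star = record
      { vs = λ v → does (v ≟ c) ∨ L v
      ; es = starEdge
      ; es-sym = λ a b → ∨-comm (does (a ≟ c) ∧ L b) _
      ; es⊆adj = star-es⊆adj
      ; es-ends = star-es-ends
      }

    star-connected : Connected ℛ star
    star-connected = hub⇒connected star c toCentre
      where
      toCentre : ∀ v → does (v ≟ c) ∨ L v ≡ true → Path ℛ starEdge v c
      toCentre v v∈ with v ≟ c
      ... | yes refl = here
      ... | no v≢c = step edge here
        where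
        edge : starEdge v c ≡ true
        edge rewrite dec-false (v ≟ c) v≢c | dec-true (c ≟ c) refl = v∈

    weight-star : weight ℛ star ≡ ∑ (λ v → if L v then w c v else 0r)
    weight-star = sym (begin
      ∑ (λ v → if L v then w c v else 0r)
        ≡⟨ ∑-indicator c (λ a → ∑ (λ b → if L b then w a b else 0r)) ⟨
      ∑ (λ a → if does (a ≟ c) then ∑ (λ b → if L b then w a b else 0r) else 0r)
        ≡⟨ ∑-cong (λ a → if-∑ (does (a ≟ c)) (λ b → if L b then w a b else 0r)) ⟩
      ∑ (λ a → ∑ (H a))
        ≡⟨ ∑∑-upper H H-diag ⟩
      ∑ (λ a → ∑ (λ b → when< a b (H a b + H b a)))
        ≡⟨ ∑-cong (λ a → ∑-cong (λ b → pair a b)) ⟩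
      weight ℛ star ∎)
      where
      open ≡-Reasoning
      H : Fin n → Fin n → ℝ
      H a b = if does (a ≟ c) then (if L b then w a b else 0r) else 0r
      H-diag : ∀ a → H a a ≡ 0r
      H-diag a with a ≟ c
      ... | yes refl rewrite L-c = refl
      ... | no _ = refl
      pair : ∀ a b → when< a b (H a b + H b a) ≡ (if (toℕ a <ᵇ toℕ b) ∧ starEdge a b then w a b else 0r)
      pair a b with toℕ a <ᵇ toℕ b in a<b
      ... | false = refl
      ... | true with a ≟ c | b ≟ c
      ...   | yes refl | yes refl =
        ⊥-elim (ℕ.<-irrefl refl (ℕ.<ᵇ⇒< (toℕ a) (toℕ a) (subst T (sym a<b) tt)))
      ...   | yes refl | no _ with L b
      ...     | true = +-identityʳ (w a b)
      ...     | false = +-identityʳ 0r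
      pair a b | true | no _ | yes refl with L a
      ...     | true = trans (+-identityˡ (w b a)) (w-sym b a)
      ...     | false = +-identityʳ 0r
      pair a b | true | no _ | no _ = +-identityʳ 0r

  module RootedAt (R : Subgraph ℛ G) (R-conn : Connected ℛ R) (r : Fin n) (r∈R : vs R r ≡ true) where

    private
      module Search = BreadthFirst {ℛ = ℛ} (es R) r

      toRoot : ∀ v → vs R v ≡ true → Path ℛ (es R) v r
      toRoot v v∈R = R-conn v r v∈R r∈R

    parent : Fin n → Fin n
    parent = Search.parent (vs R) toRoot

    parent-edge : ∀ v → vs R v ≡ true → ¬ v ≡ r → es R v (parent v) ≡ true
    parent-edge v v∈R v≢r = proj₁ (Search.parent-spec (vs R) toRoot v v∈R v≢r)

    ∑-parent-≤-weight : (J : Fin n → Bool) → (∀ v → J v ≡ true → vs R v ≡ true × ¬ v ≡ r) →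
                        ∑ (λ v → if J v then w v (parent v) else 0r) ≤ weight ℛ R
    ∑-parent-≤-weight J J⊆R∖r = ∑-descent-≤-weight R J parent (Search.level (vs R) toRoot)
      (λ v Jv → Search.parent-spec (vs R) toRoot v (proj₁ (J⊆R∖r v Jv)) (proj₂ (J⊆R∖r v Jv)))

module Realisation (ℛ : Reals) {n : ℕ} (G : WGraph ℛ n) (D : Fin n → Reals.ℝ ℛ)
                   (realises : ∀ i → IsD ℛ G (hat ℛ i) (D i)) where
  open OrderedFieldProperties ℛ
  open FiniteSums ℛ
  open EdgeWeights ℛ G
  open WGraph G
  open Subgraph

  optimal : Fin n → Subgraph ℛ G
  optimal j = proj₁ (proj₁ (realises j))

  optimal-connected : ∀ j → Connected ℛ (optimal j)
  optimal-connected j = proj₁ (proj₂ (proj₁ (realises j)))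

  optimal-spans : ∀ j → Contains ℛ (optimal j) (hat ℛ j)
  optimal-spans j = proj₁ (proj₂ (proj₂ (proj₁ (realises j))))

  weight-optimal : ∀ j → weight ℛ (optimal j) ≡ D j
  weight-optimal j = proj₂ (proj₂ (proj₂ (proj₁ (realises j))))

  D-minimal : ∀ i (R : Subgraph ℛ G) → Connected ℛ R → Contains ℛ R (hat ℛ i) → D i ≤ weight ℛ R
  D-minimal i = proj₂ (realises i)

  -- An optimal subgraph for k together with the edge kq is connected and spans G.
  D≤D+edge : ∀ i k q → adj k q ≡ true → D i ≤ D k + w k q
  D≤D+edge i k q adj-kq = begin
    D i                          ≤⟨ D-minimal i R R-connected (λ v _ → R-spans v) ⟩
    weight ℛ R                   ≤⟨ weight-∪ (optimal k) edge ⟩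
    weight ℛ (optimal k) + weight ℛ edge
      ≡⟨ cong₂ _+_ (weight-optimal k) (trans (weight-star k isQ isQ⊆adj) (∑-indicator q (w k))) ⟩
    D k + w k q                  ∎
    where
    open ≤-Reasoning
    isQ : Fin n → Bool
    isQ v = does (v ≟ q)
    isQ⊆adj : ∀ v → isQ v ≡ true → adj k v ≡ true
    isQ⊆adj v v≡q with v ≟ q
    ... | yes refl = adj-kq
    edge : Subgraph ℛ G
    edge = star k isQ isQ⊆adj
    R : Subgraph ℛ G
    R = optimal k ∪ edge
    q≢k : ¬ q ≡ k
    q≢k refl with () ← trans (sym adj-kq) (adj-irrefl q)
    R-connected : Connected ℛ R
    R-connected = ∪-connected {optimal k} {edge} (optimal-connected k) (star-connected k isQ isQ⊆adj)
      (optimal-spans k q q≢k) (∨-introʳ (dec-true (q ≟ q) refl))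
    R-spans : ∀ v → vs R v ≡ true
    R-spans v with v ≟ k
    ... | yes refl = ∨-introʳ {vs (optimal v) v} refl
    ... | no v≢k = ∨-introˡ (optimal-spans k v v≢k)

  module _ {i j : Fin n} (j≢i : ¬ j ≡ i) where

    private
      module Tree = RootedAt (optimal j) (optimal-connected j) i
                             (optimal-spans j i (λ i≡j → j≢i (sym i≡j)))

      parent-edge : ∀ k → ¬ k ≡ i → ¬ k ≡ j → es (optimal j) k (Tree.parent k) ≡ true
      parent-edge k k≢i k≢j = Tree.parent-edge k (optimal-spans j k k≢j) k≢i

    detour : Fin n → ℝ
    detour k = w k (Tree.parent k)

    0<detour : ∀ k → ¬ k ≡ i → ¬ k ≡ j → 0r < detour k
    0<detour k k≢i k≢j = es-pos (optimal j) k (Tree.parent k) (parent-edge k k≢i k≢j)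

    D≤D+detour : ∀ k → ¬ k ≡ i → ¬ k ≡ j → D i ≤ D k + detour k
    D≤D+detour k k≢i k≢j = D≤D+edge i k (Tree.parent k) (es⊆adj (optimal j) k _ (parent-edge k k≢i k≢j))

    ∑-D+detour-≤ : ∑ ((λ k → D k + detour k) ∖ i ∖ j) ≤ sumExcept ℛ D i
    ∑-D+detour-≤ = begin
      ∑ ((λ k → D k + detour k) ∖ i ∖ j)    ≡⟨ ∑-cong (∖∖-distrib-+ D detour i j) ⟩
      ∑ (λ k → (D ∖ i ∖ j) k + (detour ∖ i ∖ j) k)
                                            ≡⟨ ∑-distrib-+ (D ∖ i ∖ j) (detour ∖ i ∖ j) ⟩
      ∑ (D ∖ i ∖ j) + ∑ (detour ∖ i ∖ j)    ≤⟨ +-monoʳ-≤ (∑ (D ∖ i ∖ j)) ∑-detour-≤ ⟩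
      ∑ (D ∖ i ∖ j) + D j                   ≡⟨ ∑-∖∖ D j≢i ⟨
      ∑ (D ∖ i)                             ∎
      where
      open ≤-Reasoning
      ∑-detour-≤ : ∑ (detour ∖ i ∖ j) ≤ D j
      ∑-detour-≤ = begin
        ∑ (detour ∖ i ∖ j)                                ≡⟨ ∑-cong (∖∖-avoids detour i j) ⟩
        ∑ (λ k → if avoids i j k then detour k else 0r)   ≤⟨ Tree.∑-parent-≤-weight (avoids i j) inside ⟩
        weight ℛ (optimal j)                              ≡⟨ weight-optimal j ⟩
        D j                                               ∎
        where
        inside : ∀ k → avoids i j k ≡ true → vs (optimal j) k ≡ true × ¬ k ≡ i
        inside k k-avoids = optimal-spans j k (proj₂ (avoids⇒≢ k-avoids)) , proj₁ (avoids⇒≢ k-avoids)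

module Necessity (ℛ : Reals) (m : ℕ) (G : WGraph ℛ (suc (suc (suc m))))
                 (D : Fin (suc (suc (suc m))) → Reals.ℝ ℛ)
                 (realises : ∀ i → IsD ℛ G (hat ℛ i) (D i)) where
  open OrderedFieldProperties ℛ
  open FiniteSums ℛ
  open Realisation ℛ G D realises
  open ≤-Reasoning

  condI : CondI ℛ D
  condI i with third i i
  ... | j , j≢i , _ = begin
    ofℕ ℛ (suc m) * D i                        ≡⟨ ∑-const-∖∖ (D i) i j j≢i ⟨
    ∑ ((λ _ → D i) ∖ i ∖ j)                    ≤⟨ ∑-mono-≤ (∖∖-mono-≤ (D≤D+detour j≢i)) ⟩
    ∑ ((λ k → D k + detour j≢i k) ∖ i ∖ j)     ≤⟨ ∑-D+detour-≤ j≢i ⟩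
    sumExcept ℛ D i                            ∎

  -- Condition (i) is strict at i as soon as some other vertex k has D i ≤ D k: use a j ∉ {i, k}.
  condI-strict : ∀ i k → ¬ k ≡ i → D i ≤ D k → ofℕ ℛ (suc m) * D i < sumExcept ℛ D i
  condI-strict i k k≢i Di≤Dk with third i k
  ... | j , j≢i , j≢k = begin-strict
    ofℕ ℛ (suc m) * D i                        ≡⟨ ∑-const-∖∖ (D i) i j j≢i ⟨
    ∑ ((λ _ → D i) ∖ i ∖ j)                    <⟨ ∑-mono-< (∖∖-mono-≤ (D≤D+detour j≢i)) k at-k ⟩
    ∑ ((λ k → D k + detour j≢i k) ∖ i ∖ j)     ≤⟨ ∑-D+detour-≤ j≢i ⟩
    sumExcept ℛ D i                            ∎
    where
    k≢j : ¬ k ≡ j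
    k≢j k≡j = j≢k (sym k≡j)
    at-k : ((λ _ → D i) ∖ i ∖ j) k < ((λ k → D k + detour j≢i k) ∖ i ∖ j) k
    at-k = subst₂ _<_ (sym (∖∖-≢ (λ _ → D i) k≢i k≢j)) (sym (∖∖-≢ (λ k → D k + detour j≢i k) k≢i k≢j))
      (≤-<-trans Di≤Dk (x<x+y (D k) (0<detour j≢i k k≢i k≢j)))

  condII : CondII ℛ D
  condII (a , b , a≢b , a-max , Da≡Db) i with i ≟ a
  ... | yes refl = condI-strict i b (λ b≡i → a≢b (sym b≡i)) (≤-reflexive Da≡Db)
  ... | no i≢a = condI-strict i a (λ a≡i → i≢a (sym a≡i)) (a-max i)

module Sufficiency (ℛ : Reals) (m : ℕ) (D : Fin (suc (suc (suc m))) → Reals.ℝ ℛ)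
                   (condI : CondI ℛ D) (condII : CondII ℛ D) where
  open OrderedFieldProperties ℛ
  open FiniteSums ℛ
  open Maxima ℛ

  Vertex : Set
  Vertex = Fin (suc (suc (suc m)))

  opaque
    M : Vertex
    M = proj₁ (argmax D)

    D≤DM : ∀ k → D k ≤ D M
    D≤DM = proj₂ (argmax D)

    S : Vertex
    S = proj₁ (argmax-except D M)

    S≢M : ¬ S ≡ M
    S≢M = proj₁ (proj₂ (argmax-except D M))

    D≤DS : ∀ u → ¬ u ≡ M → D u ≤ D S
    D≤DS = proj₂ (proj₂ (argmax-except D M))

    O : Vertex
    O = proj₁ (third M S)

    O≢M : ¬ O ≡ M
    O≢M = proj₁ (proj₂ (third M S))

    O≢S : ¬ O ≡ S
    O≢S = proj₂ (proj₂ (third M S))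

  -- n − 2 = suc m
  Q : ℝ
  Q = inv (ofℕ ℛ (suc m)) (0<⇒≢0 (0<ofℕ-suc m)) * sumExcept ℛ D M

  [n-2]Q≡∑D : ofℕ ℛ (suc m) * Q ≡ sumExcept ℛ D M
  [n-2]Q≡∑D = *-inverse-cancelˡ (ofℕ ℛ (suc m)) (0<⇒≢0 (0<ofℕ-suc m)) (sumExcept ℛ D M)

  DM≤Q : D M ≤ Q
  DM≤Q = *-cancelˡ-≤ (0<ofℕ-suc m) (subst (ofℕ ℛ (suc m) * D M ≤_) (sym [n-2]Q≡∑D) (condI M))

  D<Q : ∀ v → ¬ v ≡ M → D v < Q
  D<Q v v≢M with D≤DM v
  ... | inj₁ Dv<DM = <-≤-trans Dv<DM DM≤Q
  ... | inj₂ Dv≡DM = subst (_< Q) (sym Dv≡DM) (*-cancelˡ-< (0<ofℕ-suc m)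
          (subst (ofℕ ℛ (suc m) * D M <_) (sym [n-2]Q≡∑D)
            (condII (M , v , (λ M≡v → v≢M (sym M≡v)) , D≤DM , sym Dv≡DM) M)))

  -- α v and β v are the weights of the edges Mv and Sv of the graph G below.
  α : Vertex → ℝ
  α v = Q - D v

  δ : Vertex → ℝ
  δ v = if does (v ≟ O) then D M - D S else 0r

  β : Vertex → ℝ
  β v = α v + δ v

  0<α : ∀ v → ¬ v ≡ M → 0r < α v
  0<α v v≢M = x<y⇒0<y-x (D<Q v v≢M)

  α≤β : ∀ v → α v ≤ β v
  α≤β v = x≤x+y (α v) 0≤δ
    where
    0≤δ : 0r ≤ δ v
    0≤δ with does (v ≟ O)
    ... | true = x≤y⇒0≤y-x (D≤DM S)
    ... | false = ≤-refl

  αS≤α : ∀ u → ¬ u ≡ M → α S ≤ α u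
  αS≤α u u≢M = -‿antitone-≤ Q (D≤DS u u≢M)

  ∑-α : ∑ (α ∖ M) ≡ Q
  ∑-α = +-cancelʳ-≡ (sumExcept ℛ D M) (begin
    ∑ (α ∖ M) + ∑ (D ∖ M)                   ≡⟨ ∑-distrib-+ (α ∖ M) (D ∖ M) ⟨
    ∑ (λ v → (α ∖ M) v + (D ∖ M) v)         ≡⟨ ∑-cong α+D ⟩
    ∑ ((λ _ → Q) ∖ M)                       ≡⟨ ∑-const-∖ Q M ⟩
    ofℕ ℛ (suc (suc m)) * Q                 ≡⟨ ofℕ-suc-* (suc m) Q ⟩
    Q + ofℕ ℛ (suc m) * Q                   ≡⟨ cong (Q +_) [n-2]Q≡∑D ⟩
    Q + sumExcept ℛ D M                     ∎)
    where
    open ≡-Reasoning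
    α+D : ∀ v → (α ∖ M) v + (D ∖ M) v ≡ ((λ _ → Q) ∖ M) v
    α+D v with does (v ≟ M)
    ... | true = +-identityʳ 0r
    ... | false = x-y+y≡x Q (D v)

  ∑-α-∖ : ∀ i → ¬ i ≡ M → ∑ (α ∖ M ∖ i) ≡ D i
  ∑-α-∖ i i≢M = +-cancelʳ-≡ (α i) (begin
    ∑ (α ∖ M ∖ i) + α i   ≡⟨ ∑-∖∖ α i≢M ⟨
    ∑ (α ∖ M)             ≡⟨ ∑-α ⟩
    Q                     ≡⟨ x-y+y≡x Q (D i) ⟨
    Q - D i + D i         ≡⟨ +-comm (α i) (D i) ⟩
    D i + α i             ∎)
    where open ≡-Reasoning

  ∑-β-∖ : ∑ (β ∖ M ∖ S) ≡ D M
  ∑-β-∖ = begin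
    ∑ (β ∖ M ∖ S)                        ≡⟨ ∑-cong (∖∖-distrib-+ α δ M S) ⟩
    ∑ (λ v → (α ∖ M ∖ S) v + (δ ∖ M ∖ S) v) ≡⟨ ∑-distrib-+ (α ∖ M ∖ S) (δ ∖ M ∖ S) ⟩
    ∑ (α ∖ M ∖ S) + ∑ (δ ∖ M ∖ S)
      ≡⟨ cong₂ _+_ (∑-α-∖ S S≢M) (∑-cong (∖∖-≡0 δ {M} {S} δM≡0 δS≡0)) ⟩
    D S + ∑ δ                            ≡⟨ cong (D S +_) (∑-indicator O (λ _ → D M - D S)) ⟩
    D S + (D M - D S)                    ≡⟨ +-comm (D S) (D M - D S) ⟩
    D M - D S + D S                      ≡⟨ x-y+y≡x (D M) (D S) ⟩
    D M                                  ∎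
    where
    open ≡-Reasoning
    δM≡0 : δ M ≡ 0r
    δM≡0 rewrite dec-false (M ≟ O) (λ M≡O → O≢M (sym M≡O)) = refl
    δS≡0 : δ S ≡ 0r
    δS≡0 rewrite dec-false (S ≟ O) (λ S≡O → O≢S (sym S≡O)) = refl

  isHub : Vertex → Bool
  isHub v = does (v ≟ M) ∨ does (v ≟ S)

  adjG : Vertex → Vertex → Bool
  adjG u v = (isHub u ∨ isHub v) ∧ not (does (u ≟ v))

  wG : Vertex → Vertex → ℝ
  wG u v = if does (u ≟ M) then α v else if does (v ≟ M) then α u
           else if does (u ≟ S) then β v else if does (v ≟ S) then β u else 0r

  adjG-sym : ∀ u v → adjG u v ≡ adjG v u
  adjG-sym u v rewrite ∨-comm (isHub u) (isHub v) | does-⇔ (mk⇔ sym sym) (u ≟ v) (v ≟ u) = refl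

  adjG-irrefl : ∀ v → adjG v v ≡ false
  adjG-irrefl v rewrite dec-true (v ≟ v) refl = ∧-zeroʳ _

  wG-sym : ∀ u v → wG u v ≡ wG v u
  wG-sym u v with u ≟ M | v ≟ M
  ... | yes refl | yes refl = refl
  ... | yes _ | no _ = refl
  ... | no _ | yes _ = refl
  ... | no _ | no _ with u ≟ S | v ≟ S
  ...   | yes refl | yes refl = refl
  ...   | yes _ | no _ = refl
  ...   | no _ | yes _ = refl
  ...   | no _ | no _ = refl

  wG-pos : ∀ u v → adjG u v ≡ true → 0r < wG u v
  wG-pos u v uv with u ≟ M | v ≟ M
  ... | yes refl | yes refl rewrite dec-true (u ≟ u) refl | ∧-zeroʳ (true ∨ true) with () ← uv
  ... | yes _ | no v≢M = 0<α v v≢M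
  ... | no u≢M | yes _ = 0<α u u≢M
  ... | no u≢M | no v≢M with u ≟ S | v ≟ S
  ...   | yes refl | yes refl rewrite dec-true (u ≟ u) refl | ∧-zeroʳ (true ∨ true) with () ← uv
  ...   | yes _ | no _ = <-≤-trans (0<α v v≢M) (α≤β v)
  ...   | no _ | yes _ = <-≤-trans (0<α u u≢M) (α≤β u)

  G : WGraph ℛ (suc (suc (suc m)))
  G = record { adj = adjG ; adj-sym = adjG-sym ; adj-irrefl = adjG-irrefl
             ; w = wG ; w-sym = wG-sym ; w-pos = wG-pos }

  α≤wG : ∀ v u → ¬ v ≡ M → adjG v u ≡ true → α v ≤ wG v u
  α≤wG v u v≢M vu with v ≟ M
  ... | yes v≡M = ⊥-elim (v≢M v≡M)
  ... | no _ with u ≟ M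
  ...   | yes _ = ≤-refl
  ...   | no u≢M with v ≟ S | u ≟ S
  ...     | yes refl | yes refl rewrite dec-true (v ≟ v) refl | ∧-zeroʳ (false ∨ true) with () ← vu
  ...     | yes refl | no _ = ≤-trans (αS≤α u u≢M) (α≤β u)
  ...     | no _ | yes _ = α≤β v
  ...     | no _ | no _ with () ← vu

  wG≡β : ∀ v u → ¬ v ≡ M → ¬ u ≡ M → ¬ v ≡ S → adjG v u ≡ true → wG v u ≡ β v
  wG≡β v u v≢M u≢M v≢S vu
    rewrite dec-false (v ≟ M) v≢M | dec-false (u ≟ M) u≢M | dec-false (v ≟ S) v≢S with u ≟ S
  ... | yes _ = refl
  ... | no _ with () ← vu

  open EdgeWeights ℛ G
  open Subgraph

  through-M : ∀ i (R : Subgraph ℛ G) → Connected ℛ R → Contains ℛ R (hat ℛ i) → vs R M ≡ true →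
              ∑ (α ∖ M ∖ i) ≤ weight ℛ R
  through-M i R R-conn R-spans M∈R = begin
    ∑ (α ∖ M ∖ i)                                          ≡⟨ ∑-cong (∖∖-avoids α M i) ⟩
    ∑ (λ v → if avoids M i v then α v else 0r)            ≤⟨ ∑-mono-≤ spoke≤parent ⟩
    ∑ (λ v → if avoids M i v then wG v (parent v) else 0r) ≤⟨ ∑-parent-≤-weight (avoids M i) inside ⟩
    weight ℛ R                                             ∎
    where
    open ≤-Reasoning
    open RootedAt R R-conn M M∈R
    inside : ∀ v → avoids M i v ≡ true → vs R v ≡ true × ¬ v ≡ M
    inside v v-avoids = R-spans v (proj₂ (avoids⇒≢ v-avoids)) , proj₁ (avoids⇒≢ v-avoids)
    spoke≤parent : ∀ v → (if avoids M i v then α v else 0r) ≤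
                         (if avoids M i v then wG v (parent v) else 0r)
    spoke≤parent v with avoids M i v in v-avoids
    ... | true = α≤wG v (parent v) (proj₂ (inside v v-avoids)) (es⊆adj R v (parent v) edge)
      where
      edge : es R v (parent v) ≡ true
      edge = parent-edge v (proj₁ (inside v v-avoids)) (proj₂ (inside v v-avoids))
    ... | false = ≤-refl

  -- Without M, every vertex v ∉ {M, S} of R must hang on S through its β-edge.
  avoiding-M : ∀ (R : Subgraph ℛ G) → Connected ℛ R → Contains ℛ R (hat ℛ M) → vs R M ≡ false →
               D M ≤ weight ℛ R
  avoiding-M R R-conn R-spans M∉R = begin
    D M                                                    ≡⟨ ∑-β-∖ ⟨
    ∑ (β ∖ M ∖ S)                                          ≡⟨ ∑-cong (∖∖-avoids β M S) ⟩
    ∑ (λ v → if avoids M S v then β v else 0r)            ≡⟨ ∑-cong β≡parent ⟩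
    ∑ (λ v → if avoids M S v then wG v (parent v) else 0r) ≤⟨ ∑-parent-≤-weight (avoids M S) inside ⟩
    weight ℛ R                                             ∎
    where
    open ≤-Reasoning
    open RootedAt R R-conn S (R-spans S S≢M)
    inside : ∀ v → avoids M S v ≡ true → vs R v ≡ true × ¬ v ≡ S
    inside v v-avoids = R-spans v (proj₁ (avoids⇒≢ v-avoids)) , proj₂ (avoids⇒≢ v-avoids)
    ∉R : ∀ {v} → vs R v ≡ true → ¬ v ≡ M
    ∉R v∈R refl with () ← trans (sym v∈R) M∉R
    β≡parent : ∀ v → (if avoids M S v then β v else 0r) ≡ (if avoids M S v then wG v (parent v) else 0r)
    β≡parent v with avoids M S v in v-avoids
    ... | true = sym (wG≡β v (parent v) (proj₁ (avoids⇒≢ v-avoids)) (∉R (es-endsʳ R edge))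
                   (proj₂ (avoids⇒≢ v-avoids)) (es⊆adj R v (parent v) edge))
      where
      edge : es R v (parent v) ≡ true
      edge = parent-edge v (proj₁ (inside v v-avoids)) (proj₂ (inside v v-avoids))
    ... | false = refl

  private
    M-covers : ∀ i v → ¬ v ≡ i → does (v ≟ M) ∨ avoids M i v ≡ true
    M-covers i v v≢i with v ≟ M
    ... | yes _ = refl
    ... | no _ rewrite dec-false (v ≟ i) v≢i = refl

    S-covers : ∀ v → ¬ v ≡ M → does (v ≟ S) ∨ avoids M S v ≡ true
    S-covers v v≢M with v ≟ S
    ... | yes _ = refl
    ... | no _ rewrite dec-false (v ≟ M) v≢M = refl

    M-spoke : ∀ i v → avoids M i v ≡ true → adjG M v ≡ true
    M-spoke i v v-avoids
      rewrite dec-true (M ≟ M) refl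
            | dec-false (M ≟ v) (λ M≡v → proj₁ (avoids⇒≢ v-avoids) (sym M≡v)) = refl

    S-spoke : ∀ v → avoids M S v ≡ true → adjG S v ≡ true
    S-spoke v v-avoids rewrite dec-false (S ≟ M) S≢M | dec-true (S ≟ S) refl
      | dec-false (S ≟ v) (λ S≡v → proj₂ (avoids⇒≢ v-avoids) (sym S≡v)) = refl

  realises-≢M : ∀ i → ¬ i ≡ M → IsD ℛ G (hat ℛ i) (D i)
  realises-≢M i i≢M = (spokes , star-connected M (avoids M i) (M-spoke i) , M-covers i , weight-spokes) ,
                      λ R R-conn R-spans → subst (_≤ weight ℛ R) (∑-α-∖ i i≢M)
                        (through-M i R R-conn R-spans (R-spans M (λ M≡i → i≢M (sym M≡i))))
    where
    open ≡-Reasoning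
    spokes : Subgraph ℛ G
    spokes = star M (avoids M i) (M-spoke i)
    weight-spokes : weight ℛ spokes ≡ D i
    weight-spokes = begin
      weight ℛ spokes                              ≡⟨ weight-star M (avoids M i) (M-spoke i) ⟩
      ∑ (λ v → if avoids M i v then wG M v else 0r)
        ≡⟨ ∑-cong (λ v → cong (λ t → if avoids M i v then t else 0r) (wG-M v)) ⟩
      ∑ (λ v → if avoids M i v then α v else 0r)   ≡⟨ ∑-cong (∖∖-avoids α M i) ⟨
      ∑ (α ∖ M ∖ i)                                ≡⟨ ∑-α-∖ i i≢M ⟩
      D i                                          ∎
      where
      wG-M : ∀ v → wG M v ≡ α v
      wG-M v rewrite dec-true (M ≟ M) refl = refl

  realises-M : IsD ℛ G (hat ℛ M) (D M)
  realises-M = (spokes , star-connected S (avoids M S) S-spoke , S-covers , weight-spokes) , minimal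
    where
    spokes : Subgraph ℛ G
    spokes = star S (avoids M S) S-spoke
    weight-spokes : weight ℛ spokes ≡ D M
    weight-spokes = begin
      weight ℛ spokes                              ≡⟨ weight-star S (avoids M S) S-spoke ⟩
      ∑ (λ v → if avoids M S v then wG S v else 0r) ≡⟨ ∑-cong wG-S ⟩
      ∑ (λ v → if avoids M S v then β v else 0r)   ≡⟨ ∑-cong (∖∖-avoids β M S) ⟨
      ∑ (β ∖ M ∖ S)                                ≡⟨ ∑-β-∖ ⟩
      D M                                          ∎
      where
      open ≡-Reasoning
      wG-S : ∀ v → (if avoids M S v then wG S v else 0r) ≡ (if avoids M S v then β v else 0r)
      wG-S v with avoids M S v in v-avoids
      ... | false = refl
      ... | true rewrite dec-false (S ≟ M) S≢M | dec-false (v ≟ M) (proj₁ (avoids⇒≢ v-avoids))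
                       | dec-true (S ≟ S) refl = refl
    minimal : ∀ R → Connected ℛ R → Contains ℛ R (hat ℛ M) → D M ≤ weight ℛ R
    minimal R R-conn R-spans with vs R M in M∈R
    ... | false = avoiding-M R R-conn R-spans M∈R
    ... | true = begin
      D M               ≤⟨ DM≤Q ⟩
      Q                 ≡⟨ ∑-α ⟨
      ∑ (α ∖ M)         ≡⟨ ∑-cong (∖-idem α M) ⟨
      ∑ (α ∖ M ∖ M)     ≤⟨ through-M M R R-conn R-spans M∈R ⟩
      weight ℛ R        ∎
      where open ≤-Reasoning

  realises : ∀ i → IsD ℛ G (hat ℛ i) (D i)
  realises i with i ≟ M
  ... | yes refl = realises-M
  ... | no i≢M = realises-≢M i i≢M

open import Data.Nat using (_≤_)

mainTheorem3 : (ℛ : Reals) → (n : ℕ) → 3 ≤ n →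
    (D : Fin n → Reals.ℝ ℛ) → (∀ i → Reals._<_ ℛ (Reals.0r ℛ) (D i)) →
    (Σ (WGraph ℛ n) (λ G → ∀ i → IsD ℛ G (hat ℛ i) (D i)))
      ⇔ (CondI ℛ D × CondII ℛ D)
mainTheorem3 ℛ (suc (suc (suc m))) (s≤s (s≤s (s≤s _))) D _ = mk⇔
  (λ (G , realises) → Necessity.condI ℛ m G D realises , Necessity.condII ℛ m G D realises)
  (λ (condI , condII) → Sufficiency.G ℛ m D condI condII , Sufficiency.realises ℛ m D condI condII)
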